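{- Let $n$ be a positive integer. A complete set of representatives of the equivalence classes of parabolic elements of $\mathcal M_{n^2}$ is $$\left\{\begin{pmatrix}n&a\\0&n\end{pmatrix}:\ a=1,\ldots,n,\ \gcd(a,n)=1\right\}.$$
   Context: $\mathcal M_{n^2}$ is the set of integer matrices $\begin{pmatrix}a&b\\c&d\end{pmatrix}$ with $ad-bc=n^2$ and $\gcd(a,b,c,d)=1$. An element is parabolic if it has exactly one fixed point in $\mathbb P^1(\mathbb R)$ and this fixed point lies in $\mathbb P^1(\mathbb Q)$ (and it is not scalar). Two parabolic elements $\gamma_1,\gamma_2$ are equivalent if there exist $\sigma\in\mathrm{SL}(2,\mathbb Z)$ and $\alpha$ in the stabilizer in $\mathrm{SL}(2,\mathbb Z)$ of the cusp fixed by $\gamma_2$ such that $\sigma\gamma_1\sigma^{ -1}=\alpha\gamma_2$. -}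

module Defs where

open import Data.Nat as ℕ using (ℕ)
open import Data.Nat.GCD as NG using ()
open import Data.Integer using (ℤ; +_; _+_; _*_; _-_; ∣_∣; 0ℤ; 1ℤ)
open import Data.Product using (Σ; _×_; ∃; ∃-syntax; _,_)
open import Relation.Binary.PropositionalEquality using (_≡_)
open import Relation.Nullary using (¬_)

record Mat : Set where
  constructor mat
  field
    a b c d : ℤ
open Mat public

det : Mat → ℤ
det m = a m * d m - b m * c m

_·_ : Mat → Mat → Mat
m · n = mat (a m * a n + b m * c n) (a m * b n + b m * d n)
            (c m * a n + d m * c n) (c m * b n + d m * d n)

gcd4 : Mat → ℕ
gcd4 m = NG.gcd (NG.gcd ∣ a m ∣ ∣ b m ∣) (NG.gcd ∣ c m ∣ ∣ d m ∣)

InM : ℕ → Mat → Set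
InM n m = (det m ≡ + (n ℕ.* n)) × (gcd4 m ≡ 1)

InSL2 : Mat → Set
InSL2 m = det m ≡ 1ℤ

Scalar : Mat → Set
Scalar m = (b m ≡ 0ℤ) × (c m ≡ 0ℤ) × (a m ≡ d m)

-- points of P^1(Q) given by nonzero integer column vectors (p : q), p/q
NonZeroVec : ℤ × ℤ → Set
NonZeroVec (p , q) = ¬ ((p ≡ 0ℤ) × (q ≡ 0ℤ))

SamePt : ℤ × ℤ → ℤ × ℤ → Set
SamePt (p , q) (p' , q') = p * q' ≡ p' * q

Fixes : Mat → ℤ × ℤ → Set
Fixes m (p , q) = NonZeroVec (p , q) ×
  ((a m * p + b m * q) * q ≡ (c m * p + d m * q) * p)

UniqueFixedQ : Mat → Set
UniqueFixedQ m = ∃[ v ] (Fixes m v × (∀ w → Fixes m w → SamePt v w))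

-- parabolic (for integer matrices of nonzero determinant): not scalar and
-- exactly one fixed point in P^1, which is rational.
Parabolic : Mat → Set
Parabolic m = ¬ Scalar m × UniqueFixedQ m

-- γ₁ ~ γ₂ : ∃ σ ∈ SL2(Z), α ∈ SL2(Z) in the stabilizer of the cusp fixed by γ₂,
-- with σ γ₁ σ⁻¹ = α γ₂  (written as σ γ₁ = α γ₂ σ).
Equiv : Mat → Mat → Set
Equiv γ₁ γ₂ = ∃[ σ ] ∃[ α ] (InSL2 σ × InSL2 α ×
  (∀ v → Fixes γ₂ v → Fixes α v) × (σ · γ₁ ≡ (α · γ₂) · σ))

T : ℕ → ℕ → Mat
T n x = mat (+ n) (+ x) 0ℤ (+ n)

IsIndex : ℕ → ℕ → Set
IsIndex n x = (1 ℕ.≤ x) × (x ℕ.≤ n) × (NG.gcd x n ≡ 1)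

{-# OPTIONS --safe #-}
-- Conjugating by some σ ∈ SL₂(ℤ) moves the fixed cusp of a parabolic γ to ∞, so that
-- σγσ⁻¹ = (a b ; 0 d). Uniqueness of the fixed point forces a = d (otherwise (b : d − a) is a
-- second one), and then a² = n² gives a = εn with ε = ±1. Multiplying by ε(1 k ; 0 1), which
-- stabilises ∞, reduces b modulo n to εx with 1 ≤ x ≤ n; gcd(x, n) divides every entry of
-- σγσ⁻¹ and hence of γ, so it is 1. Conversely, if σT_x = αT_yσ then α fixes ∞, comparing
-- traces shows α = (1 k ; 0 1), and the intertwining of the two translations forces
-- x = y + kn, hence x = y.
module Submission where

open import Defs
open import Data.Nat using (ℕ; _≤_)
open import Data.Product using (_×_; ∃-syntax)
open import Relation.Binary.PropositionalEquality using (_≡_)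

import Data.Nat as ℕ
import Data.Nat.Properties as ℕₚ
import Data.Nat.Divisibility as ℕᵈ
import Data.Nat.GCD as ℕᵍ
open import Data.Integer
  using (ℤ; +_; +[1+_]; -[1+_]; _+_; _*_; _-_; -_; ∣_∣; 0ℤ; 1ℤ; -1ℤ; _≟_; ≢-nonZero)
import Data.Integer.Properties as ℤₚ
import Data.Integer.Divisibility.Signed as ℤᵈ
open import Data.Integer.DivMod using (_%ℕ_; _/ℕ_; n%ℕd<d; a≡a%ℕn+[a/ℕn]*n)
open import Data.Integer.GCD using (gcd; gcd[i,j]∣i; gcd[i,j]∣j; gcd[i,j]≡0⇒i≡0; gcd[i,j]≡0⇒j≡0)
open import Data.Integer.Tactic.RingSolver using (solve-∀)
open import Data.Product using (_,_; proj₁; proj₂)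
open import Data.Sum using (inj₁; inj₂)
open import Data.Empty using (⊥-elim)
open import Function using (case_of_)
open import Relation.Nullary using (yes; no)
open import Relation.Binary.PropositionalEquality
  using (_≢_; refl; sym; trans; cong; cong₂; subst; module ≡-Reasoning)
open ≡-Reasoning

-- Integer arithmetic

*-≡0-cancelˡ : ∀ {i j} → i ≢ 0ℤ → i * j ≡ 0ℤ → j ≡ 0ℤ
*-≡0-cancelˡ {i} {j} i≢0 ij≡0 with ℤₚ.i*j≡0⇒i≡0∨j≡0 i ij≡0
... | inj₁ i≡0 = ⊥-elim (i≢0 i≡0)
... | inj₂ j≡0 = j≡0

*-cancelˡ-≢0 : ∀ {i j k} → i ≢ 0ℤ → i * j ≡ i * k → j ≡ k
*-cancelˡ-≢0 {i} {j} {k} i≢0 = ℤₚ.*-cancelˡ-≡ i j k {{≢-nonZero i≢0}}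

difference≡0 : ∀ {l r δ} → l - r ≡ δ → l ≡ r → δ ≡ 0ℤ
difference≡0 l-r≡δ l≡r = trans (sym l-r≡δ) (ℤₚ.i≡j⇒i-j≡0 l≡r)

positive≢0 : ∀ {x} → 1 ≤ x → + x ≢ 0ℤ
positive≢0 (ℕ.s≤s _) ()

i*j≡1⇒i≡j : ∀ i j → i * j ≡ 1ℤ → i ≡ j
i*j≡1⇒i≡j (+ m) j ij≡1
  with ℕₚ.m*n≡1⇒m≡1 m ∣ j ∣ (trans (sym (ℤₚ.abs-* (+ m) j)) (cong ∣_∣ ij≡1))
... | refl = trans (sym ij≡1) (ℤₚ.*-identityˡ j)
i*j≡1⇒i≡j -[1+ m ] j ij≡1
  with ℕₚ.m*n≡1⇒m≡1 (ℕ.suc m) ∣ j ∣ (trans (sym (ℤₚ.abs-* -[1+ m ] j)) (cong ∣_∣ ij≡1))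
... | refl = begin
  -1ℤ        ≡⟨ cong -_ ij≡1 ⟨
  - (-1ℤ * j) ≡⟨ cong -_ (ℤₚ.-1*i≡-i j) ⟩
  - - j       ≡⟨ ℤₚ.neg-involutive j ⟩
  j           ∎

i*i≡j*j⇒i≡±j : ∀ i j → i * i ≡ j * j → ∃[ ε ] (ε * ε ≡ 1ℤ × i ≡ ε * j)
i*i≡j*j⇒i≡±j i j i²≡j² with ℤₚ.i*j≡0⇒i≡0∨j≡0 (i - j) (difference≡0 (factor i j) i²≡j²)
  where
  factor : ∀ i j → i * i - j * j ≡ (i - j) * (i + j)
  factor = solve-∀
... | inj₁ i-j≡0 = 1ℤ , refl , trans (ℤₚ.i-j≡0⇒i≡j i j i-j≡0) (sym (ℤₚ.*-identityˡ j))
... | inj₂ i+j≡0 = -1ℤ , refl , trans (isolate i j) (trans (cong (_- j) i+j≡0) (negate j))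
  where
  isolate : ∀ i j → i ≡ (i + j) - j
  isolate = solve-∀
  negate : ∀ j → 0ℤ - j ≡ -1ℤ * j
  negate = solve-∀

residue : ∀ z n .{{_ : ℕ.NonZero n}} → ∃[ x ] ∃[ k ] (1 ≤ x × x ≤ n × z ≡ + x + k * + n)
residue z n = ℕ.suc r , q , ℕ.s≤s ℕ.z≤n , n%ℕd<d (z - 1ℤ) n , (begin
  z                         ≡⟨ shift z ⟩
  (z - 1ℤ) + 1ℤ             ≡⟨ cong (_+ 1ℤ) (a≡a%ℕn+[a/ℕn]*n (z - 1ℤ) n) ⟩
  (+ r + q * + n) + 1ℤ      ≡⟨ reassociate (+ r) q (+ n) ⟩
  + ℕ.suc r + q * + n       ∎)
  where
  r = (z - 1ℤ) %ℕ n
  q = (z - 1ℤ) /ℕ n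
  shift : ∀ z → z ≡ (z - 1ℤ) + 1ℤ
  shift = solve-∀
  reassociate : ∀ r q n → (r + q * n) + 1ℤ ≡ (1ℤ + r) + q * n
  reassociate = solve-∀

x≢y+[1+m]*n : ∀ {n x y} m → 1 ≤ y → x ≤ n → + x ≢ + y + +[1+ m ] * + n
x≢y+[1+m]*n {n} {x} {y} m 1≤y x≤n x≡y+kn = ℕₚ.≤⇒≯ x≤n (subst (n ℕ.<_) (sym x≡y+kn′) n<y+kn)
  where
  x≡y+kn′ : x ≡ y ℕ.+ ℕ.suc m ℕ.* n
  x≡y+kn′ = ℤₚ.+-injective (trans x≡y+kn (sym (trans (ℤₚ.pos-+ y _) (cong (_+_ (+ y)) (ℤₚ.pos-* (ℕ.suc m) n)))))
  n<y+kn : n ℕ.< y ℕ.+ ℕ.suc m ℕ.* n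
  n<y+kn = ℕₚ.+-mono-≤ 1≤y (ℕₚ.m≤m+n n (m ℕ.* n))

residue-unique : ∀ {n x y} k → 1 ≤ x → x ≤ n → 1 ≤ y → y ≤ n → + x ≡ + y + k * + n → x ≡ y
residue-unique {y = y} (+ 0) _ _ _ _ x≡y+0 = ℤₚ.+-injective (trans x≡y+0 (ℤₚ.+-identityʳ (+ y)))
residue-unique (+[1+ m ]) _ x≤n 1≤y _ x≡y+kn = ⊥-elim (x≢y+[1+m]*n m 1≤y x≤n x≡y+kn)
residue-unique {n} {x} {y} -[1+ m ] 1≤x _ _ y≤n x≡y-kn =
  ⊥-elim (x≢y+[1+m]*n m 1≤x y≤n (trans (solve-for-y (+ x) (+ y) (+ n) (+[1+ m ])) (cong (_+ +[1+ m ] * + n) (sym x≡y-kn))))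
  where
  solve-for-y : ∀ x y n k → y ≡ (y + (- k) * n) + k * n
  solve-for-y = solve-∀

+∣i∣≡s*i : ∀ i → ∃[ s ] (+ ∣ i ∣ ≡ s * i)
+∣i∣≡s*i (+ m)    = 1ℤ , sym (ℤₚ.*-identityˡ (+ m))
+∣i∣≡s*i -[1+ m ] = -1ℤ , sym (ℤₚ.-1*i≡-i -[1+ m ])

pos-linear : ∀ g y n x m → g ℕ.+ y ℕ.* n ≡ x ℕ.* m → + g + + y * + n ≡ + x * + m
pos-linear g y n x m eq = begin
  + g + + y * + n    ≡⟨ cong (_+_ (+ g)) (ℤₚ.pos-* y n) ⟨
  + g + + (y ℕ.* n)  ≡⟨ ℤₚ.pos-+ g (y ℕ.* n) ⟨
  + (g ℕ.+ y ℕ.* n)  ≡⟨ cong +_ eq ⟩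
  + (x ℕ.* m)        ≡⟨ ℤₚ.pos-* x m ⟩
  + x * + m          ∎

i+j-j≡i : ∀ i j → i + j - j ≡ i
i+j-j≡i = solve-∀

bezout : ∀ i j → ∃[ u ] ∃[ w ] (u * i + w * j ≡ gcd i j)
bezout i j with +∣i∣≡s*i i | +∣i∣≡s*i j | ℕᵍ.Bézout.identity (ℕᵍ.gcd-GCD ∣ i ∣ ∣ j ∣)
... | s , ∣i∣≡si | t , ∣j∣≡tj | ℕᵍ.Bézout.+- x y g+y∣j∣≡x∣i∣ = + x * s , - (+ y * t) , (begin
  + x * s * i + - (+ y * t) * j    ≡⟨ regroup (+ x) (+ y) s t i j ⟩
  + x * (s * i) - + y * (t * j)    ≡⟨ cong₂ (λ i′ j′ → + x * i′ - + y * j′) (sym ∣i∣≡si) (sym ∣j∣≡tj) ⟩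
  + x * + ∣ i ∣ - + y * + ∣ j ∣    ≡⟨ cong (_- + y * + ∣ j ∣) (pos-linear _ y (∣ j ∣) x (∣ i ∣) g+y∣j∣≡x∣i∣) ⟨
  gcd i j + + y * + ∣ j ∣ - + y * + ∣ j ∣ ≡⟨ i+j-j≡i (gcd i j) (+ y * + ∣ j ∣) ⟩
  gcd i j                          ∎)
  where
  regroup : ∀ x y s t i j → x * s * i + - (y * t) * j ≡ x * (s * i) - y * (t * j)
  regroup = solve-∀
... | s , ∣i∣≡si | t , ∣j∣≡tj | ℕᵍ.Bézout.-+ x y g+x∣i∣≡y∣j∣ = - (+ x * s) , + y * t , (begin
  - (+ x * s) * i + + y * t * j    ≡⟨ regroup (+ x) (+ y) s t i j ⟩
  + y * (t * j) - + x * (s * i)    ≡⟨ cong₂ (λ i′ j′ → + y * j′ - + x * i′) (sym ∣i∣≡si) (sym ∣j∣≡tj) ⟩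
  + y * + ∣ j ∣ - + x * + ∣ i ∣    ≡⟨ cong (_- + x * + ∣ i ∣) (pos-linear _ x (∣ i ∣) y (∣ j ∣) g+x∣i∣≡y∣j∣) ⟨
  gcd i j + + x * + ∣ i ∣ - + x * + ∣ i ∣ ≡⟨ i+j-j≡i (gcd i j) (+ x * + ∣ i ∣) ⟩
  gcd i j                          ∎)
  where
  regroup : ∀ x y s t i j → - (x * s) * i + y * t * j ≡ y * (t * j) - x * (s * i)
  regroup = solve-∀

-- 2 × 2 matrices

mat-≡ : ∀ {a₁ b₁ c₁ d₁ a₂ b₂ c₂ d₂} → a₁ ≡ a₂ → b₁ ≡ b₂ → c₁ ≡ c₂ → d₁ ≡ d₂ →
        mat a₁ b₁ c₁ d₁ ≡ mat a₂ b₂ c₂ d₂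
mat-≡ refl refl refl refl = refl

I : Mat
I = mat 1ℤ 0ℤ 0ℤ 1ℤ

adj : Mat → Mat
adj m = mat (d m) (- b m) (- c m) (a m)

trace : Mat → ℤ
trace m = a m + d m

_⊙_ : Mat → ℤ × ℤ → ℤ × ℤ
m ⊙ (p , q) = a m * p + b m * q , c m * p + d m * q

row-assoc : ∀ x y a b c d z w →
  (x * a + y * c) * z + (x * b + y * d) * w ≡ x * (a * z + b * w) + y * (c * z + d * w)
row-assoc = solve-∀

1*x+0*y≡x : ∀ x y → 1ℤ * x + 0ℤ * y ≡ x
1*x+0*y≡x = solve-∀

0*x+1*y≡y : ∀ x y → 0ℤ * x + 1ℤ * y ≡ y
0*x+1*y≡y = solve-∀

·-assoc : ∀ L M N → (L · M) · N ≡ L · (M · N)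
·-assoc (mat a₁ b₁ c₁ d₁) (mat a₂ b₂ c₂ d₂) (mat a₃ b₃ c₃ d₃) = mat-≡
  (row-assoc a₁ b₁ a₂ b₂ c₂ d₂ a₃ c₃) (row-assoc a₁ b₁ a₂ b₂ c₂ d₂ b₃ d₃)
  (row-assoc c₁ d₁ a₂ b₂ c₂ d₂ a₃ c₃) (row-assoc c₁ d₁ a₂ b₂ c₂ d₂ b₃ d₃)

·-identityˡ : ∀ M → I · M ≡ M
·-identityˡ (mat a b c d) = mat-≡ (1*x+0*y≡x a c) (1*x+0*y≡x b d) (0*x+1*y≡y a c) (0*x+1*y≡y b d)

·-identityʳ : ∀ M → M · I ≡ M
·-identityʳ (mat a b c d) = mat-≡ (x*1+y*0≡x a b) (x*0+y*1≡y a b) (x*1+y*0≡x c d) (x*0+y*1≡y c d)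
  where
  x*1+y*0≡x : ∀ x y → x * 1ℤ + y * 0ℤ ≡ x
  x*1+y*0≡x = solve-∀
  x*0+y*1≡y : ∀ x y → x * 0ℤ + y * 1ℤ ≡ y
  x*0+y*1≡y = solve-∀

det-· : ∀ M N → det (M · N) ≡ det M * det N
det-· (mat a₁ b₁ c₁ d₁) (mat a₂ b₂ c₂ d₂) = multiplicative a₁ b₁ c₁ d₁ a₂ b₂ c₂ d₂
  where
  multiplicative : ∀ a₁ b₁ c₁ d₁ a₂ b₂ c₂ d₂ →
    (a₁ * a₂ + b₁ * c₂) * (c₁ * b₂ + d₁ * d₂) - (a₁ * b₂ + b₁ * d₂) * (c₁ * a₂ + d₁ * c₂)
    ≡ (a₁ * d₁ - b₁ * c₁) * (a₂ * d₂ - b₂ * c₂)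
  multiplicative = solve-∀

det-adj : ∀ M → det (adj M) ≡ det M
det-adj (mat a b c d) = same a b c d
  where
  same : ∀ a b c d → d * a - (- b) * (- c) ≡ a * d - b * c
  same = solve-∀

det-upper : ∀ a b d → det (mat a b 0ℤ d) ≡ a * d
det-upper = drop-zero
  where
  drop-zero : ∀ a b d → a * d - b * 0ℤ ≡ a * d
  drop-zero = solve-∀

adj-involutive : ∀ M → adj (adj M) ≡ M
adj-involutive (mat a b c d) = mat-≡ refl (ℤₚ.neg-involutive b) (ℤₚ.neg-involutive c) refl

adj-inverseˡ : ∀ M → InSL2 M → adj M · M ≡ I
adj-inverseˡ (mat a b c d) det≡1 =
  mat-≡ (trans (entry₁₁ a b c d) det≡1) (entry₁₂ b d) (entry₂₁ a c) (trans (entry₂₂ a b c d) det≡1)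
  where
  entry₁₁ : ∀ a b c d → d * a + (- b) * c ≡ a * d - b * c
  entry₁₁ = solve-∀
  entry₁₂ : ∀ b d → d * b + (- b) * d ≡ 0ℤ
  entry₁₂ = solve-∀
  entry₂₁ : ∀ a c → (- c) * a + a * c ≡ 0ℤ
  entry₂₁ = solve-∀
  entry₂₂ : ∀ a b c d → (- c) * b + a * d ≡ a * d - b * c
  entry₂₂ = solve-∀

adj-inverseʳ : ∀ M → InSL2 M → M · adj M ≡ I
adj-inverseʳ M det≡1 = subst (λ N → N · adj M ≡ I) (adj-involutive M)
  (adj-inverseˡ (adj M) (trans (det-adj M) det≡1))

trace-comm : ∀ M N → trace (M · N) ≡ trace (N · M)
trace-comm (mat a₁ b₁ c₁ d₁) (mat a₂ b₂ c₂ d₂) = symmetric a₁ b₁ c₁ d₁ a₂ b₂ c₂ d₂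
  where
  symmetric : ∀ a₁ b₁ c₁ d₁ a₂ b₂ c₂ d₂ →
    (a₁ * a₂ + b₁ * c₂) + (c₁ * b₂ + d₁ * d₂) ≡ (a₂ * a₁ + b₂ * c₁) + (c₂ * b₁ + d₂ * d₁)
  symmetric = solve-∀

⊙-· : ∀ M N v → (M · N) ⊙ v ≡ M ⊙ (N ⊙ v)
⊙-· (mat a₁ b₁ c₁ d₁) (mat a₂ b₂ c₂ d₂) (p , q) =
  cong₂ _,_ (row-assoc a₁ b₁ a₂ b₂ c₂ d₂ p q) (row-assoc c₁ d₁ a₂ b₂ c₂ d₂ p q)

I-⊙ : ∀ v → I ⊙ v ≡ v
I-⊙ (p , q) = cong₂ _,_ (1*x+0*y≡x p q) (0*x+1*y≡y p q)

⊙-zero : ∀ M → M ⊙ (0ℤ , 0ℤ) ≡ (0ℤ , 0ℤ)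
⊙-zero (mat a b c d) = cong₂ _,_ (vanishes a b) (vanishes c d)
  where
  vanishes : ∀ x y → x * 0ℤ + y * 0ℤ ≡ 0ℤ
  vanishes = solve-∀

adj-⊙-cancelˡ : ∀ M v → InSL2 M → adj M ⊙ (M ⊙ v) ≡ v
adj-⊙-cancelˡ M v det≡1 = begin
  adj M ⊙ (M ⊙ v)   ≡⟨ ⊙-· (adj M) M v ⟨
  (adj M · M) ⊙ v   ≡⟨ cong (_⊙ v) (adj-inverseˡ M det≡1) ⟩
  I ⊙ v             ≡⟨ I-⊙ v ⟩
  v                 ∎

adj-⊙-cancelʳ : ∀ M v → InSL2 M → M ⊙ (adj M ⊙ v) ≡ v
adj-⊙-cancelʳ M v det≡1 = begin
  M ⊙ (adj M ⊙ v)   ≡⟨ ⊙-· M (adj M) v ⟨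
  (M · adj M) ⊙ v   ≡⟨ cong (_⊙ v) (adj-inverseʳ M det≡1) ⟩
  I ⊙ v             ≡⟨ I-⊙ v ⟩
  v                 ∎

DividesEntries : ℤ → Mat → Set
DividesEntries k m = k ℤᵈ.∣ a m × k ℤᵈ.∣ b m × k ℤᵈ.∣ c m × k ℤᵈ.∣ d m

∣-linear : ∀ {k x y} u v → k ℤᵈ.∣ x → k ℤᵈ.∣ y → k ℤᵈ.∣ x * u + y * v
∣-linear u v k∣x k∣y = ℤᵈ.∣m∣n⇒∣m+n (ℤᵈ.∣m⇒∣m*n u k∣x) (ℤᵈ.∣m⇒∣m*n v k∣y)

∣-linear′ : ∀ {k x y} u v → k ℤᵈ.∣ x → k ℤᵈ.∣ y → k ℤᵈ.∣ u * x + v * y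
∣-linear′ u v k∣x k∣y = ℤᵈ.∣m∣n⇒∣m+n (ℤᵈ.∣n⇒∣m*n u k∣x) (ℤᵈ.∣n⇒∣m*n v k∣y)

·-DividesEntriesˡ : ∀ {k} M N → DividesEntries k M → DividesEntries k (M · N)
·-DividesEntriesˡ M (mat a b c d) (k∣a , k∣b , k∣c , k∣d) =
  ∣-linear a c k∣a k∣b , ∣-linear b d k∣a k∣b , ∣-linear a c k∣c k∣d , ∣-linear b d k∣c k∣d

·-DividesEntriesʳ : ∀ {k} M N → DividesEntries k N → DividesEntries k (M · N)
·-DividesEntriesʳ (mat a b c d) N (k∣a , k∣b , k∣c , k∣d) =
  ∣-linear′ a b k∣a k∣c , ∣-linear′ a b k∣b k∣d , ∣-linear′ c d k∣a k∣c , ∣-linear′ c d k∣b k∣d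

DividesEntries⇒∣gcd4 : ∀ {k} m → DividesEntries (+ k) m → k ℕᵈ.∣ gcd4 m
DividesEntries⇒∣gcd4 m (k∣a , k∣b , k∣c , k∣d) =
  ℕᵍ.gcd-greatest (ℕᵍ.gcd-greatest (ℤᵈ.∣⇒∣ᵤ k∣a) (ℤᵈ.∣⇒∣ᵤ k∣b))
                  (ℕᵍ.gcd-greatest (ℤᵈ.∣⇒∣ᵤ k∣c) (ℤᵈ.∣⇒∣ᵤ k∣d))

-- Fixed points

fixes⇒SamePt : ∀ m {v} → Fixes m v → SamePt (m ⊙ v) v
fixes⇒SamePt m {p , q} (_ , fix) = trans fix (ℤₚ.*-comm (c m * p + d m * q) p)

SamePt⇒fixes : ∀ m {v} → NonZeroVec v → SamePt (m ⊙ v) v → Fixes m v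
SamePt⇒fixes m {p , q} v≢0 same = v≢0 , trans same (ℤₚ.*-comm p (c m * p + d m * q))

⊙-preserves-SamePt : ∀ M {v w} → SamePt v w → SamePt (M ⊙ v) (M ⊙ w)
⊙-preserves-SamePt (mat a b c d) {p , q} {p′ , q′} same = ℤₚ.i-j≡0⇒i≡j _ _ (begin
  (a * p + b * q) * (c * p′ + d * q′) - (a * p′ + b * q′) * (c * p + d * q)
    ≡⟨ cross a b c d p q p′ q′ ⟩
  (a * d - b * c) * (p * q′ - p′ * q)
    ≡⟨ cong ((a * d - b * c) *_) (ℤₚ.i≡j⇒i-j≡0 same) ⟩
  (a * d - b * c) * 0ℤ
    ≡⟨ ℤₚ.*-zeroʳ (a * d - b * c) ⟩
  0ℤ ∎)
  where
  cross : ∀ a b c d p q p′ q′ →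
    (a * p + b * q) * (c * p′ + d * q′) - (a * p′ + b * q′) * (c * p + d * q)
    ≡ (a * d - b * c) * (p * q′ - p′ * q)
  cross = solve-∀

⊙-preserves-NonZeroVec : ∀ M {v} → InSL2 M → NonZeroVec v → NonZeroVec (M ⊙ v)
⊙-preserves-NonZeroVec M {v} det≡1 v≢0 (Mv₁≡0 , Mv₂≡0) = v≢0 (cong proj₁ v≡0 , cong proj₂ v≡0)
  where
  v≡0 : v ≡ (0ℤ , 0ℤ)
  v≡0 = begin
    v                       ≡⟨ adj-⊙-cancelˡ M v det≡1 ⟨
    adj M ⊙ (M ⊙ v)         ≡⟨ cong (adj M ⊙_) (cong₂ _,_ Mv₁≡0 Mv₂≡0) ⟩
    adj M ⊙ (0ℤ , 0ℤ)       ≡⟨ ⊙-zero (adj M) ⟩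
    (0ℤ , 0ℤ)               ∎

⊙-preserves-Fixes : ∀ {σ γ γ′ v} → InSL2 σ → σ · γ ≡ γ′ · σ → Fixes γ v → Fixes γ′ (σ ⊙ v)
⊙-preserves-Fixes {σ} {γ} {γ′} {v} σ∈SL2 σγ≡γ′σ fix =
  SamePt⇒fixes γ′ (⊙-preserves-NonZeroVec σ σ∈SL2 (proj₁ fix))
    (subst (λ u → SamePt u (σ ⊙ v)) σγv≡γ′σv (⊙-preserves-SamePt σ (fixes⇒SamePt γ fix)))
  where
  σγv≡γ′σv : σ ⊙ (γ ⊙ v) ≡ γ′ ⊙ (σ ⊙ v)
  σγv≡γ′σv = begin
    σ ⊙ (γ ⊙ v)     ≡⟨ ⊙-· σ γ v ⟨
    (σ · γ) ⊙ v     ≡⟨ cong (_⊙ v) σγ≡γ′σ ⟩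
    (γ′ · σ) ⊙ v    ≡⟨ ⊙-· γ′ σ v ⟩
    γ′ ⊙ (σ ⊙ v)    ∎

c≡0⇒fixes-∞ : ∀ m {p} → c m ≡ 0ℤ → p ≢ 0ℤ → Fixes m (p , 0ℤ)
c≡0⇒fixes-∞ (mat a b c d) {p} refl p≢0 = (λ (p≡0 , _) → p≢0 p≡0) , both-vanish a b d p
  where
  both-vanish : ∀ a b d p → (a * p + b * 0ℤ) * 0ℤ ≡ (0ℤ * p + d * 0ℤ) * p
  both-vanish = solve-∀

fixes-∞⇒c≡0 : ∀ m {p} → Fixes m (p , 0ℤ) → c m ≡ 0ℤ
fixes-∞⇒c≡0 (mat a b c d) {p} (p≢0 , fix) =
  *-≡0-cancelˡ p≢0′ (*-≡0-cancelˡ p≢0′ (difference≡0 (factor a b c d p) (sym fix)))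
  where
  p≢0′ : p ≢ 0ℤ
  p≢0′ p≡0 = p≢0 (p≡0 , refl)
  factor : ∀ a b c d p → (c * p + d * 0ℤ) * p - (a * p + b * 0ℤ) * 0ℤ ≡ p * (p * c)
  factor = solve-∀

translation-fixes-only-∞ : ∀ m {p q} → c m ≡ 0ℤ → a m ≡ d m → b m ≢ 0ℤ → Fixes m (p , q) → q ≡ 0ℤ
translation-fixes-only-∞ (mat a b c d) {p} {q} refl refl b≢0 (_ , fix)
  with ℤₚ.i*j≡0⇒i≡0∨j≡0 q (*-≡0-cancelˡ b≢0 (difference≡0 (factor a b p q) fix))
  where
  factor : ∀ a b p q → (a * p + b * q) * q - (0ℤ * p + a * q) * p ≡ b * (q * q)
  factor = solve-∀
... | inj₁ q≡0 = q≡0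
... | inj₂ q≡0 = q≡0

unique-fixed-∞⇒a≡d : ∀ m {g} → c m ≡ 0ℤ → g ≢ 0ℤ →
                     (∀ w → Fixes m w → SamePt (g , 0ℤ) w) → a m ≡ d m
unique-fixed-∞⇒a≡d (mat a b c d) {g} refl g≢0 unique with a ≟ d
... | yes a≡d = a≡d
... | no a≢d = ⊥-elim (d-a≢0 d-a≡0)
  where
  d-a≢0 : d - a ≢ 0ℤ
  d-a≢0 d-a≡0 = a≢d (sym (ℤₚ.i-j≡0⇒i≡j d a d-a≡0))
  eigenvector : ∀ a b d → (a * b + b * (d - a)) * (d - a) ≡ (0ℤ * b + d * (d - a)) * b
  eigenvector = solve-∀
  d-a≡0 : d - a ≡ 0ℤ
  d-a≡0 = *-≡0-cancelˡ g≢0 (trans (unique (b , d - a) ((λ (_ , d-a≡0) → d-a≢0 d-a≡0) , eigenvector a b d))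
                                  (ℤₚ.*-zeroʳ b))

cusp-to-∞ : ∀ v → NonZeroVec v → ∃[ σ ] ∃[ g ] (InSL2 σ × σ ⊙ v ≡ (g , 0ℤ))
cusp-to-∞ (p , q) v≢0 with bezout p q | ℤᵈ.∣ᵤ⇒∣ (gcd[i,j]∣i p q) | ℤᵈ.∣ᵤ⇒∣ (gcd[i,j]∣j p q)
... | u , w , up+wq≡g | ℤᵈ.divides p′ p≡p′g | ℤᵈ.divides q′ q≡q′g =
  mat u w (- q′) p′ , g , det≡1 , cong₂ _,_ up+wq≡g second≡0
  where
  g = gcd p q
  g≢0 : g ≢ 0ℤ
  g≢0 g≡0 = v≢0 (gcd[i,j]≡0⇒i≡0 p q g≡0 , gcd[i,j]≡0⇒j≡0 {p} g≡0)
  expand : ∀ g u w p′ q′ → g * (u * p′ - w * - q′) ≡ u * (p′ * g) + w * (q′ * g)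
  expand = solve-∀
  det≡1 : u * p′ - w * - q′ ≡ 1ℤ
  det≡1 = *-cancelˡ-≢0 g≢0 (begin
    g * (u * p′ - w * - q′)       ≡⟨ expand g u w p′ q′ ⟩
    u * (p′ * g) + w * (q′ * g)   ≡⟨ cong₂ (λ i j → u * i + w * j) p≡p′g q≡q′g ⟨
    u * p + w * q                 ≡⟨ up+wq≡g ⟩
    g                             ≡⟨ ℤₚ.*-identityʳ g ⟨
    g * 1ℤ                        ∎)
  annihilates : ∀ g p′ q′ → - q′ * (p′ * g) + p′ * (q′ * g) ≡ 0ℤ
  annihilates = solve-∀
  second≡0 : - q′ * p + p′ * q ≡ 0ℤ
  second≡0 = trans (cong₂ (λ i j → - q′ * i + p′ * j) p≡p′g q≡q′g) (annihilates g p′ q′)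

-- Intertwining by SL₂(ℤ)

conj : Mat → Mat → Mat
conj σ γ = (σ · γ) · adj σ

conj-intertwines : ∀ σ γ → InSL2 σ → σ · γ ≡ conj σ γ · σ
conj-intertwines σ γ σ∈SL2 = begin
  σ · γ                     ≡⟨ ·-identityʳ (σ · γ) ⟨
  (σ · γ) · I               ≡⟨ cong ((σ · γ) ·_) (adj-inverseˡ σ σ∈SL2) ⟨
  (σ · γ) · (adj σ · σ)     ≡⟨ ·-assoc (σ · γ) (adj σ) σ ⟨
  ((σ · γ) · adj σ) · σ     ∎

module _ {σ γ γ′ : Mat} (σ∈SL2 : InSL2 σ) (σγ≡γ′σ : σ · γ ≡ γ′ · σ) where

  intertwined-inverse : γ ≡ adj σ · (γ′ · σ)
  intertwined-inverse = begin
    γ                      ≡⟨ ·-identityˡ γ ⟨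
    I · γ                  ≡⟨ cong (_· γ) (adj-inverseˡ σ σ∈SL2) ⟨
    (adj σ · σ) · γ        ≡⟨ ·-assoc (adj σ) σ γ ⟩
    adj σ · (σ · γ)        ≡⟨ cong (adj σ ·_) σγ≡γ′σ ⟩
    adj σ · (γ′ · σ)       ∎

  adj-intertwines : adj σ · γ′ ≡ γ · adj σ
  adj-intertwines = begin
    adj σ · γ′                   ≡⟨ ·-identityʳ (adj σ · γ′) ⟨
    (adj σ · γ′) · I             ≡⟨ cong ((adj σ · γ′) ·_) (adj-inverseʳ σ σ∈SL2) ⟨
    (adj σ · γ′) · (σ · adj σ)   ≡⟨ ·-assoc (adj σ · γ′) σ (adj σ) ⟨
    ((adj σ · γ′) · σ) · adj σ   ≡⟨ cong (_· adj σ) (·-assoc (adj σ) γ′ σ) ⟩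
    (adj σ · (γ′ · σ)) · adj σ   ≡⟨ cong (_· adj σ) intertwined-inverse ⟨
    γ · adj σ                    ∎

  det-intertwined : det γ ≡ det γ′
  det-intertwined = begin
    det γ              ≡⟨ ℤₚ.*-identityˡ (det γ) ⟨
    1ℤ * det γ         ≡⟨ cong (_* det γ) σ∈SL2 ⟨
    det σ * det γ      ≡⟨ det-· σ γ ⟨
    det (σ · γ)        ≡⟨ cong det σγ≡γ′σ ⟩
    det (γ′ · σ)       ≡⟨ det-· γ′ σ ⟩
    det γ′ * det σ     ≡⟨ cong (det γ′ *_) σ∈SL2 ⟩
    det γ′ * 1ℤ        ≡⟨ ℤₚ.*-identityʳ (det γ′) ⟩
    det γ′             ∎

  trace-intertwined : trace γ ≡ trace γ′
  trace-intertwined = begin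
    trace γ                     ≡⟨ cong trace intertwined-inverse ⟩
    trace (adj σ · (γ′ · σ))    ≡⟨ trace-comm (adj σ) (γ′ · σ) ⟩
    trace ((γ′ · σ) · adj σ)    ≡⟨ cong trace (·-assoc γ′ σ (adj σ)) ⟩
    trace (γ′ · (σ · adj σ))    ≡⟨ cong (λ M → trace (γ′ · M)) (adj-inverseʳ σ σ∈SL2) ⟩
    trace (γ′ · I)              ≡⟨ cong trace (·-identityʳ γ′) ⟩
    trace γ′                    ∎

  ⊙-preserves-unique-fixed-point : ∀ {v} → (∀ w → Fixes γ w → SamePt v w) →
                                   ∀ w → Fixes γ′ w → SamePt (σ ⊙ v) w
  ⊙-preserves-unique-fixed-point {v} unique w fix = subst (SamePt (σ ⊙ v)) (adj-⊙-cancelʳ σ w σ∈SL2)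
    (⊙-preserves-SamePt σ (unique (adj σ ⊙ w)
      (⊙-preserves-Fixes {adj σ} {γ′} {γ} (trans (det-adj σ) σ∈SL2) adj-intertwines fix)))

-- The representatives T n x

T-DividesEntries : ∀ n x → DividesEntries (+ ℕᵍ.gcd x n) (T n x)
T-DividesEntries n x = g∣n , ℤᵈ.∣ᵤ⇒∣ (ℕᵍ.gcd[m,n]∣m x n) , ℤᵈ.divides 0ℤ refl , g∣n
  where
  g∣n : + ℕᵍ.gcd x n ℤᵈ.∣ + n
  g∣n = ℤᵈ.∣ᵤ⇒∣ (ℕᵍ.gcd[m,n]∣n x n)

index-coprime : ∀ {γ σ α} n x → gcd4 γ ≡ 1 → InSL2 σ → σ · γ ≡ (α · T n x) · σ → ℕᵍ.gcd x n ≡ 1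
index-coprime {γ} {σ} {α} n x gcd4≡1 σ∈SL2 σγ≡αTσ =
  ℕᵈ.∣1⇒≡1 (subst (ℕᵍ.gcd x n ℕᵈ.∣_) gcd4≡1 (DividesEntries⇒∣gcd4 γ divides-γ))
  where
  divides-γ : DividesEntries (+ ℕᵍ.gcd x n) γ
  divides-γ = subst (DividesEntries _) (sym (intertwined-inverse {σ} {γ} {α · T n x} σ∈SL2 σγ≡αTσ))
    (·-DividesEntriesʳ (adj σ) _ (·-DividesEntriesˡ _ σ (·-DividesEntriesʳ α (T n x) (T-DividesEntries n x))))

T-InM : ∀ n x → ℕᵍ.gcd x n ≡ 1 → InM n (T n x)
T-InM n x gcd≡1 = trans (det-upper (+ n) (+ x) (+ n)) (sym (ℤₚ.pos-* n n)) , (begin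
  ℕᵍ.gcd (ℕᵍ.gcd n x) (ℕᵍ.gcd 0 n)  ≡⟨ cong₂ ℕᵍ.gcd (trans (ℕᵍ.gcd-comm n x) gcd≡1) (ℕᵍ.gcd-identityˡ n) ⟩
  ℕᵍ.gcd 1 n                        ≡⟨ ℕᵍ.gcd-zeroˡ n ⟩
  1                                 ∎)

T-parabolic : ∀ n x → 1 ≤ x → Parabolic (T n x)
T-parabolic n x 1≤x = (λ (x≡0 , _) → positive≢0 1≤x x≡0) , (1ℤ , 0ℤ) , c≡0⇒fixes-∞ (T n x) refl (λ ()) , only-∞
  where
  only-∞ : ∀ w → Fixes (T n x) w → SamePt (1ℤ , 0ℤ) w
  only-∞ (p , q) fix with translation-fixes-only-∞ (T n x) refl refl (positive≢0 1≤x) fix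
  ... | refl = sym (ℤₚ.*-zeroʳ p)

-- Every parabolic element is equivalent to some T n x

fixed-cusp-at-∞ : ∀ {γ σ v g} → InSL2 σ → σ ⊙ v ≡ (g , 0ℤ) → Fixes γ v → (∀ w → Fixes γ w → SamePt v w) →
                  c (conj σ γ) ≡ 0ℤ × a (conj σ γ) ≡ d (conj σ γ)
fixed-cusp-at-∞ {γ} {σ} {v} {g} σ∈SL2 σv≡g∞ fix-v unique-v = c≡0 , unique-fixed-∞⇒a≡d γ′ c≡0 g≢0 unique-g∞
  where
  γ′ = conj σ γ
  σγ≡γ′σ : σ · γ ≡ γ′ · σ
  σγ≡γ′σ = conj-intertwines σ γ σ∈SL2
  fixes-g∞ : Fixes γ′ (g , 0ℤ)
  fixes-g∞ = subst (Fixes γ′) σv≡g∞ (⊙-preserves-Fixes {σ} {γ} {γ′} σ∈SL2 σγ≡γ′σ fix-v)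
  g≢0 : g ≢ 0ℤ
  g≢0 g≡0 = proj₁ fixes-g∞ (g≡0 , refl)
  c≡0 : c γ′ ≡ 0ℤ
  c≡0 = fixes-∞⇒c≡0 γ′ {g} fixes-g∞
  unique-g∞ : ∀ w → Fixes γ′ w → SamePt (g , 0ℤ) w
  unique-g∞ = subst (λ u → ∀ w → Fixes γ′ w → SamePt u w) σv≡g∞
    (⊙-preserves-unique-fixed-point {σ} {γ} {γ′} σ∈SL2 σγ≡γ′σ unique-v)

upper-parabolic-form : ∀ n .{{_ : ℕ.NonZero n}} m → c m ≡ 0ℤ → a m ≡ d m → det m ≡ + (n ℕ.* n) →
  ∃[ x ] ∃[ α ] (1 ≤ x × x ≤ n × InSL2 α × c α ≡ 0ℤ × m ≡ α · T n x)
upper-parabolic-form n (mat A B C D) refl refl det≡n² with i*i≡j*j⇒i≡±j A (+ n) A²≡n²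
  where
  A²≡n² : A * A ≡ + n * + n
  A²≡n² = trans (sym (det-upper A B A)) (trans det≡n² (ℤₚ.pos-* n n))
... | ε , ε²≡1 , A≡εn with residue (ε * B) n
... | x , k , 1≤x , x≤n , εB≡x+kn =
  x , mat ε (ε * k) 0ℤ ε , 1≤x , x≤n , trans (det-upper ε (ε * k) ε) ε²≡1 , refl ,
  mat-≡ (trans A≡εn (entry₁₁ ε k (+ n))) B≡ (entry₂₁ ε (+ n)) (trans A≡εn (entry₂₂ ε (+ x) (+ n)))
  where
  entry₁₁ : ∀ ε k n → ε * n ≡ ε * n + ε * k * 0ℤ
  entry₁₁ = solve-∀
  entry₂₁ : ∀ ε n → 0ℤ ≡ 0ℤ * n + ε * 0ℤ
  entry₂₁ = solve-∀
  entry₂₂ : ∀ ε x n → ε * n ≡ 0ℤ * x + ε * n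
  entry₂₂ = solve-∀
  B≡ : B ≡ ε * + x + ε * k * + n
  B≡ = begin
    B                       ≡⟨ ℤₚ.*-identityˡ B ⟨
    1ℤ * B                  ≡⟨ cong (_* B) ε²≡1 ⟨
    ε * ε * B               ≡⟨ ℤₚ.*-assoc ε ε B ⟩
    ε * (ε * B)             ≡⟨ cong (ε *_) εB≡x+kn ⟩
    ε * (+ x + k * + n)     ≡⟨ distribute ε (+ x) k (+ n) ⟩
    ε * + x + ε * k * + n   ∎
    where
    distribute : ∀ ε x k n → ε * (x + k * n) ≡ ε * x + ε * k * n
    distribute = solve-∀

T-equiv-intro : ∀ {γ σ α n x} → InSL2 σ → InSL2 α → c α ≡ 0ℤ → 1 ≤ x →
                σ · γ ≡ (α · T n x) · σ → Equiv γ (T n x)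
T-equiv-intro {σ = σ} {α} {n} {x} σ∈SL2 α∈SL2 cα≡0 1≤x σγ≡αTσ = σ , α , σ∈SL2 , α∈SL2 , fixes-α , σγ≡αTσ
  where
  fixes-α : ∀ v → Fixes (T n x) v → Fixes α v
  fixes-α (p , q) fix with translation-fixes-only-∞ (T n x) refl refl (positive≢0 1≤x) fix
  ... | refl = c≡0⇒fixes-∞ α cα≡0 (λ p≡0 → proj₁ fix (p≡0 , refl))

upper-parabolic-equiv-T : ∀ n .{{_ : ℕ.NonZero n}} γ σ → InM n γ → InSL2 σ →
  c (conj σ γ) ≡ 0ℤ × a (conj σ γ) ≡ d (conj σ γ) → ∃[ x ] (IsIndex n x × Equiv γ (T n x))
upper-parabolic-equiv-T n γ σ (det≡n² , gcd4≡1) σ∈SL2 (c≡0 , a≡d) =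
  case upper-parabolic-form n (conj σ γ) c≡0 a≡d det≡n²′ of λ where
    (x , α , 1≤x , x≤n , α∈SL2 , cα≡0 , γ′≡αT) →
      x , (1≤x , x≤n , index-coprime {γ} {σ} {α} n x gcd4≡1 σ∈SL2 (intertwines γ′≡αT)) ,
      T-equiv-intro {γ} {σ} {α} σ∈SL2 α∈SL2 cα≡0 1≤x (intertwines γ′≡αT)
  where
  det≡n²′ : det (conj σ γ) ≡ + (n ℕ.* n)
  det≡n²′ = trans (sym (det-intertwined {σ} {γ} {conj σ γ} σ∈SL2 (conj-intertwines σ γ σ∈SL2))) det≡n²
  intertwines : ∀ {m} → conj σ γ ≡ m → σ · γ ≡ m · σ
  intertwines γ′≡m = subst (λ m → σ · γ ≡ m · σ) γ′≡m (conj-intertwines σ γ σ∈SL2)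

parabolic-equiv-T : ∀ n .{{_ : ℕ.NonZero n}} γ → InM n γ → Parabolic γ →
                    ∃[ x ] (IsIndex n x × Equiv γ (T n x))
parabolic-equiv-T n γ γ∈M (_ , v , fix-v , unique-v) = case cusp-to-∞ v (proj₁ fix-v) of λ where
  (σ , g , σ∈SL2 , σv≡g∞) →
    upper-parabolic-equiv-T n γ σ γ∈M σ∈SL2 (fixed-cusp-at-∞ {γ} {σ} σ∈SL2 σv≡g∞ fix-v unique-v)

-- Distinct representatives are inequivalent

-- Writing mat N x 0 N = N·I + x·E with E = (0 1 ; 0 0), the hypothesis reads x·σE = y·Eσ: its (2,2)
-- entry gives R = 0, so P = S is a unit, and its (1,2) entry then gives x = y.
translation-intertwiner : ∀ σ N x y → InSL2 σ → x ≢ 0ℤ →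
                          σ · mat N x 0ℤ N ≡ mat N y 0ℤ N · σ → x ≡ y
translation-intertwiner (mat P Q R S) N x y det≡1 x≢0 eq
  with *-≡0-cancelˡ x≢0 (difference≡0 (entry₂₂ N x Q R S) (cong d eq))
  where
  entry₂₂ : ∀ N x Q R S → (R * x + S * N) - (0ℤ * Q + N * S) ≡ x * R
  entry₂₂ = solve-∀
... | refl with i*j≡1⇒i≡j P S (trans (sym (det-upper P Q S)) det≡1)
... | refl = ℤₚ.i-j≡0⇒i≡j x y (*-≡0-cancelˡ P≢0 (difference≡0 (entry₁₂ N x y P Q) (cong b eq)))
  where
  entry₁₂ : ∀ N x y P Q → (P * x + Q * N) - (N * Q + y * P) ≡ P * (x - y)
  entry₁₂ = solve-∀
  P≢0 : P ≢ 0ℤ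
  P≢0 P≡0 with () ← trans (sym (cong₂ _*_ P≡0 P≡0)) (trans (sym (det-upper P Q P)) det≡1)

n+n≢0 : ∀ {n} → 1 ≤ n → + n + + n ≢ 0ℤ
n+n≢0 (ℕ.s≤s _) ()

unipotent-stabiliser : ∀ {σ e k f} n x y → 1 ≤ n → InSL2 σ → InSL2 (mat e k 0ℤ f) →
                       σ · T n x ≡ (mat e k 0ℤ f · T n y) · σ → e ≡ 1ℤ × f ≡ 1ℤ
unipotent-stabiliser {σ} {e} {k} {f} n x y 1≤n σ∈SL2 α∈SL2 eq
  with i*j≡1⇒i≡j e f (trans (sym (det-upper e k f)) α∈SL2)
... | refl = e≡1 , e≡1
  where
  factor : ∀ n e k y → (e * n + k * 0ℤ) + (0ℤ * y + e * n) ≡ (n + n) * e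
  factor = solve-∀
  e≡1 : e ≡ 1ℤ
  e≡1 = *-cancelˡ-≢0 (n+n≢0 1≤n) (begin
    (+ n + + n) * e                                 ≡⟨ factor (+ n) e k (+ y) ⟨
    (e * + n + k * 0ℤ) + (0ℤ * + y + e * + n)       ≡⟨ trace-intertwined {σ} {T n x} {mat e k 0ℤ e · T n y} σ∈SL2 eq ⟨
    + n + + n                                       ≡⟨ ℤₚ.*-identityʳ (+ n + + n) ⟨
    (+ n + + n) * 1ℤ                                ∎)

unipotent-·-T : ∀ k n y → mat 1ℤ k 0ℤ 1ℤ · T n y ≡ mat (+ n) (+ y + k * + n) 0ℤ (+ n)
unipotent-·-T k n y = mat-≡ (entry₁₁ k (+ n)) (entry₁₂ k (+ n) (+ y)) (entry₂₁ (+ n)) (entry₂₂ (+ n) (+ y))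
  where
  entry₁₁ : ∀ k n → 1ℤ * n + k * 0ℤ ≡ n
  entry₁₁ = solve-∀
  entry₁₂ : ∀ k n y → 1ℤ * y + k * n ≡ y + k * n
  entry₁₂ = solve-∀
  entry₂₁ : ∀ n → 0ℤ * n + 1ℤ * 0ℤ ≡ 0ℤ
  entry₂₁ = solve-∀
  entry₂₂ : ∀ n y → 0ℤ * y + 1ℤ * n ≡ n
  entry₂₂ = solve-∀

T-equiv-injective : ∀ n x y → IsIndex n x → IsIndex n y → Equiv (T n x) (T n y) → x ≡ y
T-equiv-injective n x y (1≤x , x≤n , _) (1≤y , y≤n , _) (σ , mat e k c′ f , σ∈SL2 , α∈SL2 , fixes-α , eq)
  with fixes-∞⇒c≡0 (mat e k c′ f) (fixes-α (1ℤ , 0ℤ) (c≡0⇒fixes-∞ (T n y) refl (λ ())))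
... | refl with unipotent-stabiliser {σ} {e} {k} {f} n x y (ℕₚ.≤-trans 1≤x x≤n) σ∈SL2 α∈SL2 eq
... | refl , refl = residue-unique k 1≤x x≤n 1≤y y≤n
  (translation-intertwiner σ (+ n) (+ x) (+ y + k * + n) σ∈SL2 (positive≢0 1≤x)
    (trans eq (cong (_· σ) (unipotent-·-T k n y))))

mainTheorem7 : (n : ℕ) → 1 ≤ n →
    ((x : ℕ) → IsIndex n x → InM n (T n x) × Parabolic (T n x))
    × ((γ : Mat) → InM n γ → Parabolic γ → ∃[ x ] (IsIndex n x × Equiv γ (T n x)))
    × ((x y : ℕ) → IsIndex n x → IsIndex n y → Equiv (T n x) (T n y) → x ≡ y)
mainTheorem7 n 1≤n =
  (λ x (1≤x , _ , coprime) → T-InM n x coprime , T-parabolic n x 1≤x) ,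
  parabolic-equiv-T n {{ℕ.>-nonZero 1≤n}} ,
  T-equiv-injective n
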